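{- Let $G$ be a graph and $r$ a positive integer. Then $\mathcal{R}(G)\cong \overline{K_r}$ (the edgeless graph on $r$ vertices) if and only if $G$ is an edgeless graph and $r=1$.
   Context: All graphs are finite, simple and undirected; $N(v)$ denotes the open neighbourhood of $v$. A set $S\subseteq V(G)$ is a dominating set if every vertex of $G$ is in $S$ or adjacent to a vertex of $S$; it is a minimal dominating set if no proper subset of $S$ is a dominating set. The reconfiguration graph $\mathcal{R}(G)$ has as vertex set the collection of all minimal dominating sets of $G$, and two minimal dominating sets $M_1,M_2$ are adjacent iff there is a vertex $v$ with either ($M_2\setminus M_1=\{v\}$ and $M_1\setminus M_2\subseteq N(v)$) or ($M_1\setminus M_2=\{v\}$ and $M_2\setminus M_1\subseteq N(v)$). -}

module Defs where

open import Data.Nat using (ℕ)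
open import Data.Fin using (Fin)
open import Data.Fin.Subset using (Subset; _∈_; _∉_; _⊂_; _─_; ⁅_⁆)
open import Data.Product using (Σ; ∃; ∃-syntax; _×_)
open import Data.Sum using (_⊎_)
open import Data.Empty using (⊥)
open import Relation.Nullary using (¬_)
open import Relation.Binary.PropositionalEquality using (_≡_)
open import Function.Definitions using (Injective)

record Graph (n : ℕ) : Set₁ where
  field
    Adj    : Fin n → Fin n → Set
    sym    : ∀ {u v} → Adj u v → Adj v u
    irrefl : ∀ {v} → ¬ Adj v v

open Graph public

EdgelessAdj : {r : ℕ} → Fin r → Fin r → Set
EdgelessAdj _ _ = ⊥

module _ {n : ℕ} (G : Graph n) where

  Edgeless : Set
  Edgeless = ∀ u v → ¬ Adj G u v

  Dominating : Subset n → Set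
  Dominating S = ∀ v → v ∈ S ⊎ (∃[ u ] (u ∈ S × Adj G u v))

  MinDom : Subset n → Set
  MinDom S = Dominating S × (∀ T → T ⊂ S → ¬ Dominating T)

  SubNbhd : Subset n → Fin n → Set
  SubNbhd A v = ∀ {w} → w ∈ A → Adj G v w

  -- adjacency in the reconfiguration graph R(G) (between minimal dominating sets)
  RAdj : Subset n → Subset n → Set
  RAdj M₁ M₂ = ∃[ v ] ( (M₂ ─ M₁ ≡ ⁅ v ⁆ × SubNbhd (M₁ ─ M₂) v)
                       ⊎ (M₁ ─ M₂ ≡ ⁅ v ⁆ × SubNbhd (M₂ ─ M₁) v))

  -- R(G) ≅ K̄_r : a bijection f from Fin r onto the vertex set of R(G)
  -- (the minimal dominating sets of G) preserving and reflecting adjacency.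
  RIsoEdgeless : ℕ → Set
  RIsoEdgeless r =
    Σ (Fin r → Subset n) λ f →
        Injective _≡_ _≡_ f
      × (∀ i → MinDom (f i))
      × (∀ S → MinDom S → ∃[ i ] (f i ≡ S))
      × (∀ i j → RAdj (f i) (f j) → EdgelessAdj i j)
      × (∀ i j → EdgelessAdj i j → RAdj (f i) (f j))

module Submission where

-- If G has an edge, take an independent set S of maximum size. It is dominating, hence a minimal
-- dominating set, and some m ∈ S has a neighbour. Two non-adjacent private neighbours p, q of m
-- would give the larger independent set S - m + p + q, so all private neighbours of m are
-- dominated by one neighbour v ∉ S of m. Then S - m + v still dominates, and each of its minimal
-- dominating subsets M is adjacent to S in R(G): M ─ S = {v}, and v dominates S ─ M because S is
-- independent. So R(G) edgeless forces G edgeless; then ⊤ is the only minimal dominating set and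
-- r = 1. Adjacency is not decidable constructively, but the edge case only has to refute an
-- assumption, so decidability can be assumed under a double negation.

open import Defs
open import Data.Nat using (ℕ; zero; suc; _≤_; _<_; _<?_; _∸_; z≤n)
open import Data.Nat.Induction using (<-wellFounded)
open import Data.Nat.Properties using (≤-refl; ≤-antisym; ≮⇒≥; ≤⇒≯; ∸-monoʳ-<; module ≤-Reasoning)
open import Data.Fin using (Fin; _≟_) renaming (zero to fzero; suc to fsuc)
open import Data.Fin.Properties using (all?; any?)
open import Data.Fin.Subset
  using (Subset; inside; outside; _∈_; _∉_; _⊆_; _⊂_; _─_; _-_; _∪_; ⁅_⁆; ∣_∣; ⊤; ⊥)
open import Data.Fin.Subset.Properties
  using (_∈?_; _⊂?_; ∈⊤; ∉⊥; ⊆⊤; ⊆-refl; ⊆-trans; ⊆-antisym; p⊂q⇒p⊆q; p⊂q⇒∣p∣<∣q∣; ∣p∣≤n;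
         p⊆p∪q; x∈p∪q⁻; x∈p∪q⁺; x∈⁅x⁆; x∈⁅y⁆⇒x≡y; x∉⁅y⁆⇒x≢y; p─⊥≡p; p─q⊆p;
         x∈p∧x∉q⇒x∈p─q; x∈p∧x≢y⇒x∈p-y; anySubset?)
open import Data.Fin.Subset.Induction using (⊂-wellFounded)
open import Data.Vec using (_∷_; here; there)
open import Data.Product using (_×_; _,_; proj₁; proj₂; ∃-syntax)
open import Data.Sum using (_⊎_; inj₁; inj₂; map₂)
open import Data.Empty using (⊥-elim)
open import Function.Base using (_∘_)
open import Function.Bundles using (_⇔_; mk⇔)
open import Function.Definitions using (Injective)
open import Induction.WellFounded using (WellFounded; Acc; acc; module Subrelation)
import Relation.Binary.Construct.On as On
open import Level using (0ℓ)
open import Relation.Nullary using (¬_; Dec; yes; no; ¬?)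
open import Relation.Nullary.Decidable using (_×-dec_; _⊎-dec_; _→-dec_; ¬¬-excluded-middle)
import Relation.Nullary.Decidable as Dec
open import Relation.Unary using (Pred; Decidable)
open import Relation.Binary.PropositionalEquality as ≡ using (_≡_; _≢_; refl; cong; subst)

private variable
  n : ℕ
  x y : Fin n
  p q : Subset n

¬¬-∀-Fin : {P : Fin n → Set} → (∀ i → ¬ ¬ P i) → ¬ ¬ (∀ i → P i)
¬¬-∀-Fin {zero} _ ¬∀ = ¬∀ λ ()
¬¬-∀-Fin {suc n} ¬¬P ¬∀ =
  ¬¬P fzero λ P0 → ¬¬-∀-Fin (¬¬P ∘ fsuc) λ P+ → ¬∀ λ { fzero → P0 ; (fsuc i) → P+ i }

injective-constant⇒≤1 : ∀ {r} {A : Set} {f : Fin r → A} →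
  Injective _≡_ _≡_ f → (∀ i j → f i ≡ f j) → r ≤ 1
injective-constant⇒≤1 {zero} _ _ = z≤n
injective-constant⇒≤1 {suc zero} _ _ = ≤-refl
injective-constant⇒≤1 {suc (suc r)} f-inj f-const with f-inj (f-const fzero (fsuc fzero))
... | ()

x∈p─q⇒x∉q : ∀ (p q : Subset n) → x ∈ p ─ q → x ∉ q
x∈p─q⇒x∉q (_ ∷ p) (outside ∷ q) here ()
x∈p─q⇒x∉q (_ ∷ p) (_ ∷ q) (there x∈p∖q) (there x∈q) = x∈p─q⇒x∉q p q x∈p∖q x∈q

x∈p-y⁻ : x ∈ p - y → x ∈ p × x ≢ y
x∈p-y⁻ {p = p} {y = y} x∈p-y = p─q⊆p p ⁅ y ⁆ x∈p-y , x∉⁅y⁆⇒x≢y (x∈p─q⇒x∉q p ⁅ y ⁆ x∈p-y)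

x∈p∪⁅y⁆⁻ : x ∈ p ∪ ⁅ y ⁆ → x ∈ p ⊎ x ≡ y
x∈p∪⁅y⁆⁻ {p = p} {y = y} = map₂ (x∈⁅y⁆⇒x≡y y) ∘ x∈p∪q⁻ p ⁅ y ⁆

x∈p∪⁅x⁆ : ∀ (p : Subset n) x → x ∈ p ∪ ⁅ x ⁆
x∈p∪⁅x⁆ _ x = x∈p∪q⁺ (inj₂ (x∈⁅x⁆ x))

x∉p⇒p⊂p∪⁅x⁆ : x ∉ p → p ⊂ p ∪ ⁅ x ⁆
x∉p⇒p⊂p∪⁅x⁆ {x = x} {p = p} x∉p = p⊆p∪q ⁅ x ⁆ , x , x∈p∪⁅x⁆ p x , x∉p

p─p≢⁅x⁆ : p ─ p ≢ ⁅ x ⁆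
p─p≢⁅x⁆ {p = p} {x = x} p─p≡⁅x⁆ = x∈p─q⇒x∉q p p x∈p─p (p─q⊆p p p x∈p─p)
  where
  x∈p─p : x ∈ p ─ p
  x∈p─p = subst (x ∈_) (≡.sym p─p≡⁅x⁆) (x∈⁅x⁆ x)

x∈p⇒∣p∣≡1+∣p-x∣ : x ∈ p → ∣ p ∣ ≡ suc ∣ p - x ∣
x∈p⇒∣p∣≡1+∣p-x∣ {p = inside ∷ p} here = cong suc (cong ∣_∣ (≡.sym (p─⊥≡p p)))
x∈p⇒∣p∣≡1+∣p-x∣ {p = inside ∷ p} (there x∈p) = cong suc (x∈p⇒∣p∣≡1+∣p-x∣ x∈p)
x∈p⇒∣p∣≡1+∣p-x∣ {p = outside ∷ p} (there x∈p) = x∈p⇒∣p∣≡1+∣p-x∣ x∈p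

∣p∣<∣p-x∪⁅y⁆∪⁅z⁆∣ : ∀ {x y z} → x ∈ p → y ∉ p → z ∉ p → y ≢ z →
                    ∣ p ∣ < ∣ ((p - x) ∪ ⁅ y ⁆) ∪ ⁅ z ⁆ ∣
∣p∣<∣p-x∪⁅y⁆∪⁅z⁆∣ {p = p} {x = x} {y = y} {z = z} x∈p y∉p z∉p y≢z = begin-strict
  ∣ p ∣                        ≡⟨ x∈p⇒∣p∣≡1+∣p-x∣ x∈p ⟩
  suc ∣ p - x ∣                ≤⟨ p⊂q⇒∣p∣<∣q∣ (x∉p⇒p⊂p∪⁅x⁆ y∉p-x) ⟩
  ∣ (p - x) ∪ ⁅ y ⁆ ∣          <⟨ p⊂q⇒∣p∣<∣q∣ (x∉p⇒p⊂p∪⁅x⁆ z∉p-x∪y) ⟩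
  ∣ ((p - x) ∪ ⁅ y ⁆) ∪ ⁅ z ⁆ ∣ ∎
  where
  open ≤-Reasoning
  y∉p-x : y ∉ p - x
  y∉p-x = y∉p ∘ proj₁ ∘ x∈p-y⁻
  z∉p-x∪y : z ∉ (p - x) ∪ ⁅ y ⁆
  z∉p-x∪y z∈ with x∈p∪⁅y⁆⁻ z∈
  ... | inj₁ z∈p-x = z∉p (proj₁ (x∈p-y⁻ z∈p-x))
  ... | inj₂ refl = y≢z refl

module _ (P : Pred (Subset n) 0ℓ) where

  Minimal : Subset n → Set
  Minimal M = P M × (∀ T → T ⊂ M → ¬ P T)

  Maximum : Subset n → Set
  Maximum M = P M × (∀ T → P T → ∣ T ∣ ≤ ∣ M ∣)

module _ {P : Pred (Subset n) 0ℓ} (P? : Decidable P) where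

  minimal-⊆ : ∀ {S} → P S → ∃[ M ] (M ⊆ S × Minimal P M)
  minimal-⊆ {S} = go (⊂-wellFounded S)
    where
    go : ∀ {S} → Acc _⊂_ S → P S → ∃[ M ] (M ⊆ S × Minimal P M)
    go {S} (acc rs) PS with anySubset? (λ T → (T ⊂? S) ×-dec P? T)
    ... | yes (T , T⊂S , PT) = let M , M⊆T , min = go (rs T⊂S) PT
                               in M , ⊆-trans M⊆T (p⊂q⇒p⊆q T⊂S) , min
    ... | no ¬smaller = S , ⊆-refl , PS , λ T T⊂S PT → ¬smaller (T , T⊂S , PT)

  maximum : ∀ {S} → P S → ∃[ M ] Maximum P M
  maximum {S} = go (larger-wellFounded S)
    where
    _≻_ : Subset n → Subset n → Set
    T ≻ S = ∣ S ∣ < ∣ T ∣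

    larger-wellFounded : WellFounded _≻_
    larger-wellFounded = Subrelation.wellFounded (λ {T} S<T → ∸-monoʳ-< S<T (∣p∣≤n T))
      (On.wellFounded (λ S → n ∸ ∣ S ∣) <-wellFounded)

    go : ∀ {S} → Acc _≻_ S → P S → ∃[ M ] Maximum P M
    go {S} (acc rs) PS with anySubset? (λ T → P? T ×-dec (∣ S ∣ <? ∣ T ∣))
    ... | yes (T , PT , S<T) = go (rs S<T) PT
    ... | no ¬larger = S , PS , λ T PT → ≮⇒≥ λ S<T → ¬larger (T , PT , S<T)

module _ {n : ℕ} (G : Graph n) where

  Independent : Subset n → Set
  Independent S = ∀ {u v} → u ∈ S → v ∈ S → ¬ Adj G u v

  PrivateNeighbour : Subset n → Fin n → Fin n → Set
  PrivateNeighbour S m x = x ∉ S × Adj G m x × ¬ (∃[ y ] (y ∈ S × y ≢ m × Adj G y x))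

  PrivateNeighboursDominatedBy : Subset n → Fin n → Fin n → Set
  PrivateNeighboursDominatedBy S m v = ∀ x → PrivateNeighbour S m x → x ≡ v ⊎ Adj G v x

  independent-⊆ : p ⊆ q → Independent q → Independent p
  independent-⊆ p⊆q ind u∈p v∈p = ind (p⊆q u∈p) (p⊆q v∈p)

  independent-∪⁅⁆ : ∀ {S x} → Independent S → (∀ {y} → y ∈ S → ¬ Adj G x y) →
                    Independent (S ∪ ⁅ x ⁆)
  independent-∪⁅⁆ ind x≁S u∈ v∈ uv with x∈p∪⁅y⁆⁻ u∈ | x∈p∪⁅y⁆⁻ v∈
  ... | inj₁ u∈S | inj₁ v∈S = ind u∈S v∈S uv
  ... | inj₁ u∈S | inj₂ refl = x≁S u∈S (Graph.sym G uv)
  ... | inj₂ refl | inj₁ v∈S = x≁S v∈S uv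
  ... | inj₂ refl | inj₂ refl = irrefl G uv

  independent-dominating⇒minimal : ∀ {S} → Independent S → Dominating G S → MinDom G S
  independent-dominating⇒minimal {S} ind dom = dom , λ T (T⊆S , x , x∈S , x∉T) domT →
    undominated T⊆S x∈S x∉T (domT x)
    where
    undominated : ∀ {T x} → T ⊆ S → x ∈ S → x ∉ T → ¬ (x ∈ T ⊎ ∃[ u ] (u ∈ T × Adj G u x))
    undominated _ _ x∉T (inj₁ x∈T) = x∉T x∈T
    undominated T⊆S x∈S _ (inj₂ (u , u∈T , ux)) = ind (T⊆S u∈T) x∈S ux

  edgeless-dominating⇒≡⊤ : Edgeless G → ∀ {S} → Dominating G S → S ≡ ⊤
  edgeless-dominating⇒≡⊤ edgeless {S} dom = ⊆-antisym ⊆⊤ λ {x} _ → self-dominated (dom x)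
    where
    self-dominated : ∀ {x} → x ∈ S ⊎ ∃[ u ] (u ∈ S × Adj G u x) → x ∈ S
    self-dominated (inj₁ x∈S) = x∈S
    self-dominated {x} (inj₂ (u , _ , ux)) = ⊥-elim (edgeless u x ux)

  RAdj-irrefl : ∀ {M} → ¬ RAdj G M M
  RAdj-irrefl (_ , inj₁ (M─M≡⁅v⁆ , _)) = p─p≢⁅x⁆ M─M≡⁅v⁆
  RAdj-irrefl (_ , inj₂ (M─M≡⁅v⁆ , _)) = p─p≢⁅x⁆ M─M≡⁅v⁆

  dominating⇒non-isolated-member : ∀ {S a b} → Dominating G S → Adj G a b →
                                   ∃[ m ] ∃[ u ] (m ∈ S × Adj G m u)
  dominating⇒non-isolated-member {a = a} {b} dom ab with dom a
  ... | inj₁ a∈S = a , b , a∈S , ab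
  ... | inj₂ (y , y∈S , ya) = y , a , y∈S , ya

  private-neighbour-≁ : ∀ {S m x y} → PrivateNeighbour S m x → y ∈ S - m → ¬ Adj G x y
  private-neighbour-≁ (_ , _ , unique) y∈S-m xy =
    let y∈S , y≢m = x∈p-y⁻ y∈S-m in unique (_ , y∈S , y≢m , Graph.sym G xy)

  -- Otherwise ((S - m) ∪ ⁅ p ⁆) ∪ ⁅ q ⁆ would be a larger independent set.
  maximum-private-neighbours-adjacent : ∀ {S m p q} → Maximum Independent S → m ∈ S →
    PrivateNeighbour S m p → PrivateNeighbour S m q → p ≢ q → ¬ ¬ Adj G p q
  maximum-private-neighbours-adjacent {S} {m} {p} {q} (ind , max) m∈S pp pq p≢q ¬pq =
    ≤⇒≯ (max _ ind′) (∣p∣<∣p-x∪⁅y⁆∪⁅z⁆∣ m∈S (proj₁ pp) (proj₁ pq) p≢q)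
    where
    q≁S-m∪p : ∀ {y} → y ∈ (S - m) ∪ ⁅ p ⁆ → ¬ Adj G q y
    q≁S-m∪p y∈ with x∈p∪⁅y⁆⁻ y∈
    ... | inj₁ y∈S-m = private-neighbour-≁ pq y∈S-m
    ... | inj₂ refl = ¬pq ∘ Graph.sym G

    ind′ : Independent (((S - m) ∪ ⁅ p ⁆) ∪ ⁅ q ⁆)
    ind′ = independent-∪⁅⁆ (independent-∪⁅⁆ (independent-⊆ (p─q⊆p S ⁅ m ⁆) ind)
                                           (private-neighbour-≁ pp))
                           q≁S-m∪p

  exchange-RAdj : ∀ {S m v M} → Independent S → m ∈ S → v ∉ S → Adj G m v →
                  M ⊆ (S - m) ∪ ⁅ v ⁆ → Dominating G M → RAdj G S M
  exchange-RAdj {S} {m} {v} {M} ind m∈S v∉S mv M⊆ domM = v , inj₁ (M─S≡⁅v⁆ , S─M⊆N[v])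
    where
    member : ∀ {y} → y ∈ M → y ≡ v ⊎ (y ∈ S × y ≢ m)
    member y∈M with x∈p∪⁅y⁆⁻ (M⊆ y∈M)
    ... | inj₁ y∈S-m = inj₂ (x∈p-y⁻ y∈S-m)
    ... | inj₂ y≡v = inj₁ y≡v

    dominated-by-v : ∀ {y} → y ∈ S → y ∉ M → v ∈ M × Adj G v y
    dominated-by-v {y} y∈S y∉M with domM y
    ... | inj₁ y∈M = ⊥-elim (y∉M y∈M)
    ... | inj₂ (z , z∈M , zy) with member z∈M
    ...   | inj₁ refl = z∈M , zy
    ...   | inj₂ (z∈S , _) = ⊥-elim (ind z∈S y∈S zy)

    m∉M : m ∉ M
    m∉M m∈M with member m∈M
    ... | inj₁ refl = v∉S m∈S
    ... | inj₂ (_ , m≢m) = m≢m refl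

    v∈M : v ∈ M
    v∈M = proj₁ (dominated-by-v m∈S m∉M)

    M─S⊆⁅v⁆ : M ─ S ⊆ ⁅ v ⁆
    M─S⊆⁅v⁆ y∈M─S with member (p─q⊆p M S y∈M─S)
    ... | inj₁ refl = x∈⁅x⁆ v
    ... | inj₂ (y∈S , _) = ⊥-elim (x∈p─q⇒x∉q M S y∈M─S y∈S)

    M─S≡⁅v⁆ : M ─ S ≡ ⁅ v ⁆
    M─S≡⁅v⁆ = ⊆-antisym M─S⊆⁅v⁆ λ y∈⁅v⁆ →
      subst (_∈ M ─ S) (≡.sym (x∈⁅y⁆⇒x≡y v y∈⁅v⁆)) (x∈p∧x∉q⇒x∈p─q v∈M v∉S)

    S─M⊆N[v] : SubNbhd G (S ─ M) v
    S─M⊆N[v] y∈S─M = proj₂ (dominated-by-v (p─q⊆p S M y∈S─M) (x∈p─q⇒x∉q S M y∈S─M))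

module WithDecidableAdjacency {n : ℕ} (G : Graph n) (adj? : ∀ u v → Dec (Adj G u v)) where

  dominated? : ∀ S v → Dec (v ∈ S ⊎ ∃[ u ] (u ∈ S × Adj G u v))
  dominated? S v = (v ∈? S) ⊎-dec any? λ u → (u ∈? S) ×-dec adj? u v

  dominating? : Decidable (Dominating G)
  dominating? S = all? (dominated? S)

  independent? : Decidable (Independent G)
  independent? S = Dec.map′ (λ ind {u} {v} → ind u v) (λ ind u v → ind)
    (all? λ u → all? λ v → (u ∈? S) →-dec (v ∈? S) →-dec ¬? (adj? u v))

  other-dominator? : ∀ S m x → Dec (∃[ y ] (y ∈ S × y ≢ m × Adj G y x))
  other-dominator? S m x = any? λ y → (y ∈? S) ×-dec ¬? (y ≟ m) ×-dec adj? y x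

  private-neighbour? : ∀ S m → Decidable (PrivateNeighbour G S m)
  private-neighbour? S m x = ¬? (x ∈? S) ×-dec adj? m x ×-dec ¬? (other-dominator? S m x)

  maximum-independent⇒dominating : ∀ {S} → Maximum (Independent G) S → Dominating G S
  maximum-independent⇒dominating {S} (ind , max) v with dominated? S v
  ... | yes dominated = dominated
  ... | no undominated =
    ⊥-elim (≤⇒≯ (max _ ind′) (p⊂q⇒∣p∣<∣q∣ (x∉p⇒p⊂p∪⁅x⁆ (undominated ∘ inj₁))))
    where
    ind′ : Independent G (S ∪ ⁅ v ⁆)
    ind′ = independent-∪⁅⁆ G ind λ u∈S vu → undominated (inj₂ (_ , u∈S , Graph.sym G vu))

  exchange-vertex : ∀ {S m u} → Maximum (Independent G) S → m ∈ S → Adj G m u →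
    ∃[ v ] (v ∉ S × Adj G m v × PrivateNeighboursDominatedBy G S m v)
  exchange-vertex {S} {m} {u} max m∈S mu with any? (private-neighbour? S m)
  ... | no none = u , (λ u∈S → proj₁ max m∈S u∈S mu) , mu , λ x px → ⊥-elim (none (x , px))
  ... | yes (p , pp) = p , proj₁ pp , proj₁ (proj₂ pp) , p-dominates
    where
    p-dominates : PrivateNeighboursDominatedBy G S m p
    p-dominates x px with x ≟ p | adj? p x
    ... | yes x≡p | _ = inj₁ x≡p
    ... | no _ | yes px′ = inj₂ px′
    ... | no x≢p | no ¬px =
      ⊥-elim (maximum-private-neighbours-adjacent G max m∈S pp px (x≢p ∘ ≡.sym) ¬px)

  exchange-dominating : ∀ {S m v} → Dominating G S → Adj G m v →
    PrivateNeighboursDominatedBy G S m v → Dominating G ((S - m) ∪ ⁅ v ⁆)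
  exchange-dominating {S} {m} {v} dom mv v-dominates x
    with x ≟ m | x ∈? S | other-dominator? S m x
  ... | yes refl | _ | _ = inj₂ (v , x∈p∪⁅x⁆ (S - m) v , Graph.sym G mv)
  ... | no x≢m | yes x∈S | _ = inj₁ (x∈p∪q⁺ (inj₁ (x∈p∧x≢y⇒x∈p-y x∈S x≢m)))
  ... | no _ | no _ | yes (y , y∈S , y≢m , yx) =
    inj₂ (y , x∈p∪q⁺ (inj₁ (x∈p∧x≢y⇒x∈p-y y∈S y≢m)) , yx)
  ... | no _ | no x∉S | no none with dom x
  ...   | inj₁ x∈S = ⊥-elim (x∉S x∈S)
  ...   | inj₂ (y , y∈S , yx) with y ≟ m
  ...     | no y≢m = ⊥-elim (none (y , y∈S , y≢m , yx))
  ...     | yes refl with v-dominates x (x∉S , yx , none)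
  ...       | inj₁ refl = inj₁ (x∈p∪⁅x⁆ (S - m) x)
  ...       | inj₂ vx = inj₂ (v , x∈p∪⁅x⁆ (S - m) v , vx)

  R-edge : ∀ {a b} → Adj G a b → ∃[ M₁ ] ∃[ M₂ ] (MinDom G M₁ × MinDom G M₂ × RAdj G M₁ M₂)
  R-edge ab =
    let S , maxS@(indS , _) = maximum independent? {⊥} λ u∈⊥ _ _ → ∉⊥ u∈⊥
        domS = maximum-independent⇒dominating maxS
        m , u , m∈S , mu = dominating⇒non-isolated-member G domS ab
        v , v∉S , mv , v-dominates = exchange-vertex maxS m∈S mu
        M , M⊆ , minM = minimal-⊆ dominating? (exchange-dominating domS mv v-dominates)
    in S , M , independent-dominating⇒minimal G indS domS , minM
         , exchange-RAdj G indS m∈S v∉S mv M⊆ (proj₁ minM)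

¬¬-decidable-Adj : ∀ {n} (G : Graph n) → ¬ ¬ (∀ u v → Dec (Adj G u v))
¬¬-decidable-Adj G = ¬¬-∀-Fin λ u → ¬¬-∀-Fin λ v → ¬¬-excluded-middle

RIsoEdgeless⇒¬RAdj : ∀ {n r} (G : Graph n) → RIsoEdgeless G r →
  ∀ {M₁ M₂} → MinDom G M₁ → MinDom G M₂ → ¬ RAdj G M₁ M₂
RIsoEdgeless⇒¬RAdj G (_ , _ , _ , onto , reflects , _) min₁ min₂ adj
  with onto _ min₁ | onto _ min₂
... | i , refl | j , refl = reflects i j adj

theorem10 : (n : ℕ) (G : Graph n) (r : ℕ) → 1 ≤ r →
    (RIsoEdgeless G r ⇔ (Edgeless G × r ≡ 1))
theorem10 n G r 1≤r = mk⇔ to from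
  where
  to : RIsoEdgeless G r → Edgeless G × r ≡ 1
  to iso@(_ , f-injective , f-minimal , _) = edgeless , ≤-antisym r≤1 1≤r
    where
    edgeless : Edgeless G
    edgeless a b ab = ¬¬-decidable-Adj G λ adj? →
      let _ , _ , min₁ , min₂ , adj = WithDecidableAdjacency.R-edge G adj? ab
      in RIsoEdgeless⇒¬RAdj G iso min₁ min₂ adj
    r≤1 : r ≤ 1
    r≤1 = injective-constant⇒≤1 f-injective λ i j →
      ≡.trans (edgeless-dominating⇒≡⊤ G edgeless (proj₁ (f-minimal i)))
              (≡.sym (edgeless-dominating⇒≡⊤ G edgeless (proj₁ (f-minimal j))))
  from : Edgeless G × r ≡ 1 → RIsoEdgeless G r
  from (edgeless , refl) =
    (λ _ → ⊤) , (λ { {fzero} {fzero} _ → refl }) , (λ _ → ⊤-minimal)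
    , (λ _ min → fzero , ≡.sym (edgeless-dominating⇒≡⊤ G edgeless (proj₁ min)))
    , (λ _ _ → RAdj-irrefl G) , λ _ _ ()
    where
    ⊤-minimal : MinDom G ⊤
    ⊤-minimal = independent-dominating⇒minimal G (λ {u} {v} _ _ → edgeless u v) λ _ → inj₁ ∈⊤
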